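{- Assume the Hardy–Littlewood prime $k$-tuple conjecture for pairs of linear forms. Then there exist infinitely many primes $p$ such that $14$ flanks $2p$ at distance $1$ at every occurrence; that is, there is at least one $k\ge 0$ with $2p\in S_k$, and for every $k$ with $2p\in S_k$ we have $k\ge 1$, $14\in S_{k-1}$ and $14\in S_{k+1}$.
   Context: For integers $k\ge 0$ and $n\ge 1$, $\sigma_k(n)=\sum_{d\mid n} d^k$ and $\phi(n)$ is Euler's totient function. For each $k\geq 0$, $S_k$ denotes the set of composite positive integers $n$ satisfying $n\cdot\sigma_k(n)\equiv 2 \pmod{\phi(n)}$. The Hardy–Littlewood prime $k$-tuple conjecture for pairs of linear forms asserts: if $f_1(n)=a_1n+b_1$ and $f_2(n)=a_2n+b_2$ are linear forms with integer coefficients, $a_i>0$, forming an admissible pair (i.e., for every prime $q$ there is an integer $n$ with $q\nmid f_1(n)f_2(n)$, and each $f_i$ has $\gcd(a_i,b_i)=1$), then there are infinitely many integers $n$ for which $f_1(n)$ and $f_2(n)$ are both prime. -}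

module Defs where

open import Data.Nat using (ℕ; zero; suc; _+_; _*_; _^_; _<_; _≤_)
open import Data.Nat.Divisibility using (_∣?_)
open import Data.Nat.GCD using (gcd)
open import Data.Nat.Primality using (Prime; Composite)
open import Data.List using (List; filter; map; length; upTo)
open import Data.Nat.ListAction using (sum)
open import Relation.Binary.PropositionalEquality using (_≡_)
open import Data.Integer as ℤ using (ℤ; +_)
import Data.Integer.Divisibility as ℤD
open import Data.Product using (_×_; ∃; ∃-syntax)
open import Relation.Nullary using (¬_)
open import Data.Nat using (_≟_)

oneTo : ℕ → List ℕ
oneTo n = map suc (upTo n)

σ : ℕ → ℕ → ℕ
σ k n = sum (map (λ d → d ^ k) (filter (λ d → d ∣? n) (oneTo n)))

φ : ℕ → ℕ
φ n = length (filter (λ m → gcd m n ≟ 1) (oneTo n))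

CongMod : ℕ → ℕ → ℕ → Set
CongMod a b m = (+ m) ℤD.∣ ((+ a) ℤ.- (+ b))

S : ℕ → ℕ → Set
S k n = Composite n × CongMod (n * σ k n) 2 (φ n)

_∣ℤ_ : ℤ → ℤ → Set
a ∣ℤ b = a ℤD.∣ b

IsPrimeℤ : ℤ → Set
IsPrimeℤ z = ∃[ p ] (z ≡ + p × Prime p)

HardyLittlewoodPairs : Set
HardyLittlewoodPairs =
  (a₁ b₁ a₂ b₂ : ℤ) →
  ℤ.+0 ℤ.< a₁ → ℤ.+0 ℤ.< a₂ →
  gcd ℤ.∣ a₁ ∣ ℤ.∣ b₁ ∣ ≡ 1 →
  gcd ℤ.∣ a₂ ∣ ℤ.∣ b₂ ∣ ≡ 1 →
  ((q : ℕ) → Prime q → ∃[ n ] ¬ ((+ q) ∣ℤ ((a₁ ℤ.* n ℤ.+ b₁) ℤ.* (a₂ ℤ.* n ℤ.+ b₂)))) →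
  (N : ℤ) → ∃[ n ] (N ℤ.< n × IsPrimeℤ (a₁ ℤ.* n ℤ.+ b₁) × IsPrimeℤ (a₂ ℤ.* n ℤ.+ b₂))

-- For an odd prime p = 2s + 1 one has σ_k(2p) = (1 + 2^k)(1 + p^k) and φ(2p) = 2s, so
-- 2p ∈ S_k exactly when s ∣ 1 + 2^(k+1).  Take s = 5r where r = 8t + 5 and p = 80t + 51 are
-- both prime, as the conjecture provides for infinitely many t.  Then 5 ∣ 1 + 2^(k+1) forces
-- k ≡ 1 (mod 4), and 14 ∈ S_j for every even j.  Conversely k = 4t + 1 works, since
-- 2^(4t+2) ≡ -1 modulo 5 and, by Gauss's lemma (2 is a non-residue modulo r ≡ 5 (mod 8)),
-- modulo r as well.
module Submission where

open import Defs
open import Data.Nat using (ℕ; suc; _<_; _*_)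
open import Data.Nat.Primality using (Prime)
open import Data.Product using (_×_; ∃-syntax)
open import Relation.Binary.PropositionalEquality using (_≡_)

open import Level using (0ℓ)
open import Function using (id; _∘_; _⇔_; mk⇔; Equivalence)
open import Data.Sum using (_⊎_; inj₁; inj₂; [_,_]′; map₂)
open import Data.Product using (_,_; proj₁; proj₂)
open import Data.List using ([]; _∷_; _++_; _∷ʳ_; [_]; filter; map; length; upTo)
open import Data.List.Properties using (upTo-∷ʳ; map-++; filter-++; filter-accept; filter-reject; ++-identityʳ; length-++)
open import Data.Nat.ListAction using (sum)
open import Data.Nat using (zero; NonZero; _+_; _∸_; _^_; _!; _≤_; _≤′_; ≤′-refl; ≤′-step; z≤n; s≤s; _≟_)
open import Data.Nat.Properties
open import Data.Nat.Divisibility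
open import Data.Nat.GCD using (gcd; gcd-greatest)
open import Data.Nat.Coprimality as Coprime using (Coprime; coprime⇒gcd≡1; gcd≡1⇒coprime; coprime-divisor; prime⇒coprime)
open import Data.Nat.Primality using (Composite; composite-≢; euclidsLemma; prime⇒nonZero; prime⇒irreducible; prime[2]; ¬prime[1])
open import Data.Nat.Tactic.RingSolver using (solve-∀)
open import Data.Integer as ℤ using (ℤ; +_; -1ℤ; 1ℤ; +<+)
import Data.Integer.Properties as ℤ
import Data.Integer.Tactic.RingSolver as ℤ-Solver
open import Relation.Binary.PropositionalEquality using (_≢_; refl; sym; trans; cong; cong₂; subst; subst₂; module ≡-Reasoning)
open import Relation.Nullary using (¬_; yes; no; contradiction)
open import Relation.Nullary.Decidable using (from-no)
open import Relation.Unary using (Pred; Decidable)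

module _ {P : Pred ℕ 0ℓ} (P? : Decidable P) where

  filter-oneTo-suc : ∀ n → filter P? (oneTo (suc n)) ≡ filter P? (oneTo n) ++ filter P? [ suc n ]
  filter-oneTo-suc n = begin
    filter P? (map suc (upTo (suc n)))       ≡⟨ cong (filter P? ∘ map suc) (upTo-∷ʳ n) ⟨
    filter P? (map suc (upTo n ∷ʳ n))        ≡⟨ cong (filter P?) (map-++ suc (upTo n) [ n ]) ⟩
    filter P? (oneTo n ∷ʳ suc n)             ≡⟨ filter-++ P? (oneTo n) [ suc n ] ⟩
    filter P? (oneTo n) ++ filter P? [ suc n ] ∎
    where open ≡-Reasoning

  filter-oneTo-accept : ∀ {n} → P (suc n) → filter P? (oneTo (suc n)) ≡ filter P? (oneTo n) ∷ʳ suc n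
  filter-oneTo-accept {n} Pn = trans (filter-oneTo-suc n) (cong (filter P? (oneTo n) ++_) (filter-accept P? Pn))

  filter-oneTo-reject : ∀ {n} → ¬ P (suc n) → filter P? (oneTo (suc n)) ≡ filter P? (oneTo n)
  filter-oneTo-reject {n} ¬Pn = begin
    filter P? (oneTo (suc n))                ≡⟨ filter-oneTo-suc n ⟩
    filter P? (oneTo n) ++ filter P? [ suc n ] ≡⟨ cong (filter P? (oneTo n) ++_) (filter-reject P? ¬Pn) ⟩
    filter P? (oneTo n) ++ []                ≡⟨ ++-identityʳ _ ⟩
    filter P? (oneTo n)                      ∎
    where open ≡-Reasoning

  filter-oneTo-gap : ∀ {a b} → a ≤ b → (∀ {d} → a < d → d ≤ b → ¬ P d) → filter P? (oneTo b) ≡ filter P? (oneTo a)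
  filter-oneTo-gap a≤b = go (≤⇒≤′ a≤b)
    where
    go : ∀ {a b} → a ≤′ b → (∀ {d} → a < d → d ≤ b → ¬ P d) → filter P? (oneTo b) ≡ filter P? (oneTo a)
    go ≤′-refl           _  = refl
    go (≤′-step a≤′b) ∉P = trans (filter-oneTo-reject (∉P (s≤s (≤′⇒≤ a≤′b)) ≤-refl))
                                 (go a≤′b (λ a<d d≤b → ∉P a<d (m≤n⇒m≤1+n d≤b)))

  length-filter-oneTo-pairs : ∀ a j → (∀ {i} → i < j → P (suc (2 * (a + i))) × ¬ P (suc (suc (2 * (a + i))))) →
                              length (filter P? (oneTo (2 * (a + j)))) ≡ length (filter P? (oneTo (2 * a))) + j
  length-filter-oneTo-pairs a zero _ = begin
    length (filter P? (oneTo (2 * (a + 0)))) ≡⟨ cong (λ n → length (filter P? (oneTo (2 * n)))) (+-identityʳ a) ⟩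
    length (filter P? (oneTo (2 * a)))       ≡⟨ +-identityʳ _ ⟨
    length (filter P? (oneTo (2 * a))) + 0   ∎
    where open ≡-Reasoning
  length-filter-oneTo-pairs a (suc j) pairs = begin
    length (filter P? (oneTo (2 * (a + suc j))))         ≡⟨ cong (length ∘ filter P? ∘ oneTo) (double-suc a j) ⟩
    length (filter P? (oneTo (suc (suc (2 * (a + j)))))) ≡⟨ cong length (filter-oneTo-reject (proj₂ (pairs ≤-refl))) ⟩
    length (filter P? (oneTo (suc (2 * (a + j)))))       ≡⟨ cong length (filter-oneTo-accept (proj₁ (pairs ≤-refl))) ⟩
    length (filter P? (oneTo (2 * (a + j))) ∷ʳ _)        ≡⟨ length-++ (filter P? (oneTo (2 * (a + j)))) ⟩
    length (filter P? (oneTo (2 * (a + j)))) + 1         ≡⟨ cong (_+ 1) (length-filter-oneTo-pairs a j (pairs ∘ m<n⇒m<1+n)) ⟩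
    length (filter P? (oneTo (2 * a))) + j + 1           ≡⟨ trans (+-comm _ 1) (sym (+-suc _ j)) ⟩
    length (filter P? (oneTo (2 * a))) + suc j           ∎
    where
    open ≡-Reasoning
    double-suc : ∀ a j → 2 * (a + suc j) ≡ suc (suc (2 * (a + j)))
    double-suc = solve-∀

∣*prime⇒ : ∀ {d n p} → Prime p → d ∣ n * p → d ∣ n ⊎ ∃[ e ] (d ≡ e * p × e ∣ n)
∣*prime⇒ {d} {n} {p} p-prime (divides q n*p≡q*d) with euclidsLemma q d p-prime (divides n (sym n*p≡q*d))
... | inj₂ (divides e refl) = inj₂ (e , refl , *-cancelʳ-∣ p {{prime⇒nonZero p-prime}} (divides q n*p≡q*d))
... | inj₁ (divides f refl) = inj₁ (divides f (*-cancelʳ-≡ n (f * d) p {{prime⇒nonZero p-prime}} (trans n*p≡q*d (swap f p d))))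
  where
  swap : ∀ f p d → f * p * d ≡ f * d * p
  swap = solve-∀

∣2*prime⇒ : ∀ {d p} → Prime p → d ∣ 2 * p → d ≡ 1 ⊎ d ≡ 2 ⊎ d ≡ p ⊎ d ≡ 2 * p
∣2*prime⇒ {d} {p} p-prime d∣2p with ∣*prime⇒ p-prime d∣2p
... | inj₁ d∣2 = map₂ inj₁ (prime⇒irreducible prime[2] d∣2)
... | inj₂ (e , refl , e∣2) with prime⇒irreducible prime[2] e∣2
...   | inj₁ refl = inj₂ (inj₂ (inj₁ (+-identityʳ p)))
...   | inj₂ refl = inj₂ (inj₂ (inj₂ refl))

m∣n<2m⇒n≡m : ∀ {m n} → m ∣ n → .{{NonZero n}} → n < 2 * m → n ≡ m
m∣n<2m⇒n≡m {m} (divides 1 refl) _ = +-identityʳ m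
m∣n<2m⇒n≡m {m} (divides (suc (suc q)) refl) n<2m = contradiction n<2m (≤⇒≯ (+-monoʳ-≤ m (+-monoʳ-≤ m z≤n)))

coprime-2*prime : ∀ {m p} → Prime p → 2 ∤ m → p ∤ m → Coprime m (2 * p)
coprime-2*prime {p = p} p-prime 2∤m p∤m (d∣m , d∣2p) with ∣2*prime⇒ p-prime d∣2p
... | inj₁ d≡1 = d≡1
... | inj₂ (inj₁ refl) = contradiction d∣m 2∤m
... | inj₂ (inj₂ (inj₁ refl)) = contradiction d∣m p∤m
... | inj₂ (inj₂ (inj₂ refl)) = contradiction (m*n∣⇒m∣ 2 p d∣m) 2∤m

2∤1+2n : ∀ n → 2 ∤ suc (2 * n)
2∤1+2n n 2∣1+2n = contradiction (∣1⇒≡1 (∣m+n∣m⇒∣n (subst (2 ∣_) (+-comm 1 (2 * n)) 2∣1+2n) (m∣m*n n))) λ ()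

odd-prime⇒1≤half : ∀ {s} → Prime (suc (2 * s)) → 1 ≤ s
odd-prime⇒1≤half {zero}  p-prime = contradiction p-prime ¬prime[1]
odd-prime⇒1≤half {suc s} _       = s≤s z≤n

[1+m]^n≡1+m*q : ∀ m n → ∃[ q ] (1 + m) ^ n ≡ 1 + m * q
[1+m]^n≡1+m*q m zero    = 0 , cong suc (sym (*-zeroʳ m))
[1+m]^n≡1+m*q m (suc n) with [1+m]^n≡1+m*q m n
... | q , eq = 1 + q + m * q , trans (cong ((1 + m) *_) eq) (expand m q)
  where
  expand : ∀ m q → (1 + m) * (1 + m * q) ≡ 1 + m * (1 + q + m * q)
  expand = solve-∀

^-distrib-* : ∀ m n k → (m * n) ^ k ≡ m ^ k * n ^ k
^-distrib-* m n zero    = refl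
^-distrib-* m n (suc k) = trans (cong (m * n *_) (^-distrib-* m n k)) (interchange m n (m ^ k) (n ^ k))
  where
  interchange : ∀ a b c d → a * b * (c * d) ≡ a * c * (b * d)
  interchange = solve-∀

module _ {s : ℕ} (p-prime : Prime (suc (2 * s))) where

  private
    p : ℕ
    p = suc (2 * s)

    1≤2s : 1 ≤ 2 * s
    1≤2s = ≤-trans (odd-prime⇒1≤half p-prime) (m≤m+n s (s + 0))

  filter-divisors-2p : filter (λ d → d ∣? 2 * p) (oneTo (2 * p)) ≡ (1 ∷ 2 ∷ []) ∷ʳ p ∷ʳ 2 * p
  filter-divisors-2p = begin
    filter D? (oneTo (2 * p))                    ≡⟨ filter-oneTo-accept D? ∣-refl ⟩
    filter D? (oneTo (2 * p ∸ 1)) ∷ʳ 2 * p       ≡⟨ cong (_∷ʳ 2 * p) (filter-oneTo-gap D? p≤2p-1 ∤-above-p) ⟩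
    filter D? (oneTo p) ∷ʳ 2 * p                 ≡⟨ cong (_∷ʳ 2 * p) (filter-oneTo-accept D? (n∣m*n 2)) ⟩
    filter D? (oneTo (2 * s)) ∷ʳ p ∷ʳ 2 * p      ≡⟨ cong (λ xs → xs ∷ʳ p ∷ʳ 2 * p) (filter-oneTo-gap D? 2≤2s ∤-below-p) ⟩
    filter D? (oneTo 2) ∷ʳ p ∷ʳ 2 * p            ≡⟨ cong (λ xs → xs ∷ʳ p ∷ʳ 2 * p) 1,2∣2p ⟩
    (1 ∷ 2 ∷ []) ∷ʳ p ∷ʳ 2 * p                   ∎
    where
    open ≡-Reasoning
    D? : Decidable (_∣ 2 * p)
    D? d = d ∣? 2 * p

    p≤2p-1 : p ≤ 2 * p ∸ 1
    p≤2p-1 = ≤-pred (m<m+n p {p + 0} (s≤s z≤n))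

    2≤2s : 2 ≤ 2 * s
    2≤2s = *-monoʳ-≤ 2 {1} {s} (odd-prime⇒1≤half p-prime)

    ∤-above-p : ∀ {d} → p < d → d ≤ 2 * p ∸ 1 → d ∤ 2 * p
    ∤-above-p p<d d<2p d∣2p with ∣2*prime⇒ p-prime d∣2p
    ... | inj₁ refl                = <⇒≱ p<d (s≤s z≤n)
    ... | inj₂ (inj₁ refl)         = <⇒≱ p<d (s≤s 1≤2s)
    ... | inj₂ (inj₂ (inj₁ refl))  = n≮n p p<d
    ... | inj₂ (inj₂ (inj₂ refl))  = n≮n _ d<2p

    ∤-below-p : ∀ {d} → 2 < d → d ≤ 2 * s → d ∤ 2 * p
    ∤-below-p 2<d d≤2s d∣2p with ∣2*prime⇒ p-prime d∣2p
    ... | inj₁ refl                = <⇒≱ 2<d (s≤s z≤n)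
    ... | inj₂ (inj₁ refl)         = n≮n 2 2<d
    ... | inj₂ (inj₂ (inj₁ refl))  = n≮n _ d≤2s
    ... | inj₂ (inj₂ (inj₂ refl))  = <⇒≱ (<-≤-trans (n<1+n (2 * s)) (m≤m+n p (p + 0))) d≤2s

    1,2∣2p : filter D? (oneTo 2) ≡ 1 ∷ 2 ∷ []
    1,2∣2p = trans (filter-oneTo-accept D? (m∣m*n p)) (cong (_∷ʳ 2) (filter-oneTo-accept D? (1∣ _)))

  σ-2p : ∀ k → σ k (2 * p) ≡ 1 ^ k + (2 ^ k + (p ^ k + ((2 * p) ^ k + 0)))
  σ-2p k = cong (sum ∘ map (_^ k)) filter-divisors-2p

  private
    C? : Decidable (λ m → gcd m (2 * p) ≡ 1)
    C? m = gcd m (2 * p) ≟ 1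

    odd-coprime : ∀ {n} → n ≢ s → n ≤ 2 * s → gcd (suc (2 * n)) (2 * p) ≡ 1
    odd-coprime {n} n≢s n≤2s = coprime⇒gcd≡1 (coprime-2*prime p-prime (2∤1+2n n) p∤1+2n)
      where
      1+2n<2p : suc (2 * n) < 2 * p
      1+2n<2p = subst (_≤ 2 * p) (*-suc 2 n) (*-monoʳ-≤ 2 (s≤s n≤2s))
      p∤1+2n : p ∤ suc (2 * n)
      p∤1+2n p∣1+2n = n≢s (*-cancelˡ-≡ n s 2 (suc-injective (m∣n<2m⇒n≡m p∣1+2n 1+2n<2p)))

    even-not-coprime : ∀ n → gcd (suc (suc (2 * n))) (2 * p) ≢ 1
    even-not-coprime n gcd≡1 = contradiction (gcd≡1⇒coprime {suc (suc (2 * n))} {2 * p} gcd≡1 (2∣2+2n , m∣m*n p)) λ ()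
      where
      2∣2+2n : 2 ∣ suc (suc (2 * n))
      2∣2+2n = divides (suc n) (trans (sym (*-suc 2 n)) (*-comm 2 (suc n)))

    p-not-coprime : gcd p (2 * p) ≢ 1
    p-not-coprime gcd≡1 = ¬prime[1] (subst Prime (gcd≡1⇒coprime {p} {2 * p} gcd≡1 (∣-refl , n∣m*n 2)) p-prime)

  φ-2p : φ (2 * p) ≡ 2 * s
  φ-2p = begin
    length (filter C? (oneTo (2 * p)))                   ≡⟨ cong (length ∘ filter C? ∘ oneTo ∘ (2 *_)) (p≡ s) ⟩
    length (filter C? (oneTo (2 * (suc s + s))))         ≡⟨ length-filter-oneTo-pairs C? (suc s) s pairs-above-p ⟩
    length (filter C? (oneTo (2 * suc s))) + s           ≡⟨ cong (λ n → length (filter C? (oneTo n)) + s) (*-suc 2 s) ⟩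
    length (filter C? (oneTo (suc (suc (2 * s))))) + s   ≡⟨ cong (λ xs → length xs + s) p,p+1∤ ⟩
    length (filter C? (oneTo (2 * (0 + s)))) + s         ≡⟨ cong (_+ s) (length-filter-oneTo-pairs C? 0 s pairs-below-p) ⟩
    s + s                                                ≡⟨ cong (_+_ s) (+-identityʳ s) ⟨
    2 * s                                                ∎
    where
    open ≡-Reasoning
    p≡ : ∀ s → suc (2 * s) ≡ suc s + s
    p≡ = solve-∀

    pairs-below-p : ∀ {i} → i < s → gcd (suc (2 * i)) (2 * p) ≡ 1 × gcd (suc (suc (2 * i))) (2 * p) ≢ 1
    pairs-below-p {i} i<s = odd-coprime (<⇒≢ i<s) (≤-trans (<⇒≤ i<s) (m≤m+n s (s + 0))) , even-not-coprime i

    pairs-above-p : ∀ {i} → i < s → gcd (suc (2 * (suc s + i))) (2 * p) ≡ 1 × gcd (suc (suc (2 * (suc s + i)))) (2 * p) ≢ 1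
    pairs-above-p {i} i<s = odd-coprime (>⇒≢ (s≤s (m≤m+n s i)))
                                        (≤-trans (+-monoʳ-< s i<s) (≤-reflexive (cong (_+_ s) (sym (+-identityʳ s)))))
                    , even-not-coprime (suc s + i)

    p,p+1∤ : filter C? (oneTo (suc (suc (2 * s)))) ≡ filter C? (oneTo (2 * s))
    p,p+1∤ = trans (filter-oneTo-reject C? (even-not-coprime s)) (filter-oneTo-reject C? p-not-coprime)

  private
    2p*σ-2p : ∀ k → ∃[ y ] 2 * p * σ k (2 * p) ≡ 2 + (2 * s * y + 2 * (1 + 2 ^ suc k))
    2p*σ-2p k with [1+m]^n≡1+m*q (2 * s) k
    ... | a , p^k≡ = 2 * (1 + 2 ^ k) * (2 + a + 2 * s * a) , (begin
      2 * p * σ k (2 * p)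
        ≡⟨ cong (2 * p *_) (σ-2p k) ⟩
      2 * p * (1 ^ k + (2 ^ k + (p ^ k + ((2 * p) ^ k + 0))))
        ≡⟨ cong₂ (λ x y → 2 * p * (x + (2 ^ k + (p ^ k + (y + 0))))) (^-zeroˡ k) (^-distrib-* 2 p k) ⟩
      2 * p * (1 + (2 ^ k + (p ^ k + (2 ^ k * p ^ k + 0))))
        ≡⟨ cong (λ x → 2 * p * (1 + (2 ^ k + (x + (2 ^ k * x + 0))))) p^k≡ ⟩
      2 * p * (1 + (2 ^ k + (1 + 2 * s * a + (2 ^ k * (1 + 2 * s * a) + 0))))
        ≡⟨ expand s (2 ^ k) a ⟩
      2 + (2 * s * (2 * (1 + 2 ^ k) * (2 + a + 2 * s * a)) + 2 * (1 + 2 ^ suc k)) ∎)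
      where
      open ≡-Reasoning
      expand : ∀ s b a → 2 * suc (2 * s) * (1 + (b + (1 + 2 * s * a + (b * (1 + 2 * s * a) + 0))))
                         ≡ 2 + (2 * s * (2 * (1 + b) * (2 + a + 2 * s * a)) + 2 * (1 + 2 * b))
      expand = solve-∀

    -- CongMod (2 + x) 2 m unfolds to m ∣ x.
    congMod-2p⇔ : ∀ k → CongMod (2 * p * σ k (2 * p)) 2 (φ (2 * p)) ⇔ s ∣ 1 + 2 ^ suc k
    congMod-2p⇔ k with 2p*σ-2p k
    ... | y , eq rewrite eq | φ-2p =
      mk⇔ (λ 2s∣ → *-cancelˡ-∣ 2 (∣m+n∣m⇒∣n 2s∣ (m∣m*n y))) (λ s∣ → ∣m∣n⇒∣m+n (m∣m*n y) (*-monoʳ-∣ 2 s∣))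

    composite-2p : Composite (2 * p)
    composite-2p = composite-≢ 2 (<⇒≢ (*-monoʳ-< 2 (s≤s 1≤2s))) (m∣m*n p)

  S[2p]⇔ : ∀ k → S k (2 * suc (2 * s)) ⇔ s ∣ 1 + 2 ^ suc k
  S[2p]⇔ k = mk⇔ (Equivalence.to (congMod-2p⇔ k) ∘ proj₂) ((composite-2p ,_) ∘ Equivalence.from (congMod-2p⇔ k))

14∈S[2v] : ∀ v → S (2 * v) 14
14∈S[2v] v with [1+m]^n≡1+m*q 3 v | [1+m]^n≡1+m*q 48 v | [1+m]^n≡1+m*q 195 v
... | a , 4^v≡ | b , 49^v≡ | c , 196^v≡ =
  composite-≢ 2 (λ ()) (divides 7 refl) , subst (λ n → CongMod n 2 (φ 14)) (sym 14*σ≡) (m∣m*n (9 + 7 * a + 112 * b + 455 * c))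
  where
  open ≡-Reasoning
  square : ∀ m → m ^ (2 * v) ≡ (m * m) ^ v
  square m = trans (sym (^-*-assoc m 2 v)) (cong (_^ v) (cong (m *_) (*-identityʳ m)))
  expand : ∀ a b c → 14 * (1 + (1 + 3 * a + (1 + 48 * b + (1 + 195 * c + 0)))) ≡ 2 + 6 * (9 + 7 * a + 112 * b + 455 * c)
  expand = solve-∀
  14*σ≡ : 14 * σ (2 * v) 14 ≡ 2 + 6 * (9 + 7 * a + 112 * b + 455 * c)
  14*σ≡ = begin
    14 * (1 ^ (2 * v) + (2 ^ (2 * v) + (7 ^ (2 * v) + (14 ^ (2 * v) + 0))))
      ≡⟨ cong (λ x → 14 * (x + (2 ^ (2 * v) + (7 ^ (2 * v) + (14 ^ (2 * v) + 0))))) (^-zeroˡ (2 * v)) ⟩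
    14 * (1 + (2 ^ (2 * v) + (7 ^ (2 * v) + (14 ^ (2 * v) + 0))))
      ≡⟨ cong₂ (λ x y → 14 * (1 + (x + y))) (trans (square 2) 4^v≡)
               (cong₂ (λ x y → x + (y + 0)) (trans (square 7) 49^v≡) (trans (square 14) 196^v≡)) ⟩
    14 * (1 + (1 + 3 * a + (1 + 48 * b + (1 + 195 * c + 0))))
      ≡⟨ expand a b c ⟩
    2 + 6 * (9 + 7 * a + 112 * b + 455 * c) ∎

5∣1+2^[4+n]⇔5∣1+2^n : ∀ n → 5 ∣ 1 + 2 ^ (4 + n) ⇔ 5 ∣ 1 + 2 ^ n
5∣1+2^[4+n]⇔5∣1+2^n n =
  mk⇔ (λ 5∣ → ∣m+n∣m⇒∣n (subst (5 ∣_) (split (2 ^ n)) 5∣) (n∣m*n (3 * 2 ^ n)))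
      (λ 5∣ → subst (5 ∣_) (sym (split (2 ^ n))) (∣m∣n⇒∣m+n (n∣m*n (3 * 2 ^ n)) 5∣))
  where
  split : ∀ x → 1 + 2 * (2 * (2 * (2 * x))) ≡ 3 * x * 5 + (1 + x)
  split = solve-∀

5∣1+2^n⇒n≡2+4u : ∀ n → 5 ∣ 1 + 2 ^ n → ∃[ u ] n ≡ 2 + 4 * u
5∣1+2^n⇒n≡2+4u 0 5∣ = contradiction 5∣ (from-no (5 ∣? 2))
5∣1+2^n⇒n≡2+4u 1 5∣ = contradiction 5∣ (from-no (5 ∣? 3))
5∣1+2^n⇒n≡2+4u 2 5∣ = 0 , refl
5∣1+2^n⇒n≡2+4u 3 5∣ = contradiction 5∣ (from-no (5 ∣? 9))
5∣1+2^n⇒n≡2+4u (suc (suc (suc (suc n)))) 5∣ with 5∣1+2^n⇒n≡2+4u n (Equivalence.to (5∣1+2^[4+n]⇔5∣1+2^n n) 5∣)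
... | u , refl = suc u , cong (_+_ 2) (sym (*-suc 4 u))

5∣1+2^[2+4u] : ∀ u → 5 ∣ 1 + 2 ^ (2 + 4 * u)
5∣1+2^[2+4u] zero    = divides 1 refl
5∣1+2^[2+4u] (suc u) = subst (λ n → 5 ∣ 1 + 2 ^ (2 + n)) (sym (*-suc 4 u))
                         (Equivalence.from (5∣1+2^[4+n]⇔5∣1+2^n (2 + 4 * u)) (5∣1+2^[2+4u] u))

rising₂ : ℤ → ℕ → ℤ
rising₂ a zero    = 1ℤ
rising₂ a (suc m) = rising₂ a m ℤ.* (a ℤ.+ (+ m ℤ.+ + m))

rising₂-+ : ∀ a m n → rising₂ a (m + n) ≡ rising₂ a m ℤ.* rising₂ (a ℤ.+ (+ m ℤ.+ + m)) n
rising₂-+ a m zero    = trans (cong (rising₂ a) (+-identityʳ m)) (sym (ℤ.*-identityʳ _))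
rising₂-+ a m (suc n) = begin
  rising₂ a (m + suc n)
    ≡⟨ cong (rising₂ a) (+-suc m n) ⟩
  rising₂ a (m + n) ℤ.* (a ℤ.+ (+ (m + n) ℤ.+ + (m + n)))
    ≡⟨ cong₂ (λ x y → x ℤ.* (a ℤ.+ (y ℤ.+ y))) (rising₂-+ a m n) (ℤ.pos-+ m n) ⟩
  rising₂ a m ℤ.* r ℤ.* (a ℤ.+ ((+ m ℤ.+ + n) ℤ.+ (+ m ℤ.+ + n)))
    ≡⟨ regroup (rising₂ a m) r a (+ m) (+ n) ⟩
  rising₂ a m ℤ.* (r ℤ.* (a ℤ.+ (+ m ℤ.+ + m) ℤ.+ (+ n ℤ.+ + n))) ∎
  where
  open ≡-Reasoning
  r : ℤ
  r = rising₂ (a ℤ.+ (+ m ℤ.+ + m)) n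
  regroup : ∀ x y a m n → x ℤ.* y ℤ.* (a ℤ.+ ((m ℤ.+ n) ℤ.+ (m ℤ.+ n))) ≡ x ℤ.* (y ℤ.* (a ℤ.+ (m ℤ.+ m) ℤ.+ (n ℤ.+ n)))
  regroup = ℤ-Solver.solve-∀

-- Pairs a + 2i with b + 2(m - i), whose sum is the modulus.
rising₂-reflect : ∀ m a b →
                  ∃[ c ] rising₂ a m ≡ -1ℤ ℤ.^ m ℤ.* rising₂ (b ℤ.+ + 2) m ℤ.+ c ℤ.* (a ℤ.+ b ℤ.+ (+ m ℤ.+ + m))
rising₂-reflect zero    a b = + 0 , refl
rising₂-reflect (suc m) a b with rising₂-reflect m a (b ℤ.+ + 2)
... | c , eq = -1ℤ ℤ.^ m ℤ.* q ℤ.+ c ℤ.* (a ℤ.+ (+ m ℤ.+ + m)) , (begin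
  rising₂ a m ℤ.* (a ℤ.+ (+ m ℤ.+ + m))
    ≡⟨ cong (ℤ._* (a ℤ.+ (+ m ℤ.+ + m))) eq ⟩
  (-1ℤ ℤ.^ m ℤ.* q ℤ.+ c ℤ.* (a ℤ.+ (b ℤ.+ + 2) ℤ.+ (+ m ℤ.+ + m))) ℤ.* (a ℤ.+ (+ m ℤ.+ + m))
    ≡⟨ regroup (-1ℤ ℤ.^ m) q c a b (+ m) ⟩
  -1ℤ ℤ.* -1ℤ ℤ.^ m ℤ.* (rising₂ (b ℤ.+ + 2) 1 ℤ.* q) ℤ.+ c′ ℤ.* (a ℤ.+ b ℤ.+ (+ suc m ℤ.+ + suc m))
    ≡⟨ cong (λ x → -1ℤ ℤ.* -1ℤ ℤ.^ m ℤ.* x ℤ.+ c′ ℤ.* (a ℤ.+ b ℤ.+ (+ suc m ℤ.+ + suc m)))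
            (rising₂-+ (b ℤ.+ + 2) 1 m) ⟨
  -1ℤ ℤ.* -1ℤ ℤ.^ m ℤ.* rising₂ (b ℤ.+ + 2) (suc m) ℤ.+ c′ ℤ.* (a ℤ.+ b ℤ.+ (+ suc m ℤ.+ + suc m)) ∎)
  where
  open ≡-Reasoning
  q : ℤ
  q = rising₂ (b ℤ.+ + 2 ℤ.+ + 2) m
  c′ : ℤ
  c′ = -1ℤ ℤ.^ m ℤ.* q ℤ.+ c ℤ.* (a ℤ.+ (+ m ℤ.+ + m))
  regroup : ∀ e q c a b m →
            (e ℤ.* q ℤ.+ c ℤ.* (a ℤ.+ (b ℤ.+ + 2) ℤ.+ (m ℤ.+ m))) ℤ.* (a ℤ.+ (m ℤ.+ m))
            ≡ -1ℤ ℤ.* e ℤ.* (1ℤ ℤ.* ((b ℤ.+ + 2) ℤ.+ + 0) ℤ.* q)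
              ℤ.+ (e ℤ.* q ℤ.+ c ℤ.* (a ℤ.+ (m ℤ.+ m))) ℤ.* (a ℤ.+ b ℤ.+ ((+ 1 ℤ.+ m) ℤ.+ (+ 1 ℤ.+ m)))
  regroup = ℤ-Solver.solve-∀

rising₂[2]≡2^n*n! : ∀ n → rising₂ (+ 2) n ≡ + (2 ^ n * n !)
rising₂[2]≡2^n*n! zero    = refl
rising₂[2]≡2^n*n! (suc n) = begin
  rising₂ (+ 2) n ℤ.* + (2 + (n + n))   ≡⟨ cong (ℤ._* + (2 + (n + n))) (rising₂[2]≡2^n*n! n) ⟩
  + (2 ^ n * n !) ℤ.* + (2 + (n + n))   ≡⟨ ℤ.pos-* (2 ^ n * n !) (2 + (n + n)) ⟨
  + (2 ^ n * n ! * (2 + (n + n)))       ≡⟨ cong +_ (regroup (2 ^ n) (n !) n) ⟩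
  + (2 ^ suc n * suc n !)               ∎
  where
  open ≡-Reasoning
  regroup : ∀ x y n → x * y * (2 + (n + n)) ≡ 2 * x * (suc n * y)
  regroup = solve-∀

rising₂[2]*rising₂[1]≡[n+n]! : ∀ n → rising₂ (+ 2) n ℤ.* rising₂ (+ 1) n ≡ + ((n + n) !)
rising₂[2]*rising₂[1]≡[n+n]! zero    = refl
rising₂[2]*rising₂[1]≡[n+n]! (suc n) = begin
  rising₂ (+ 2) n ℤ.* (+ 2 ℤ.+ (+ n ℤ.+ + n)) ℤ.* (rising₂ (+ 1) n ℤ.* (+ 1 ℤ.+ (+ n ℤ.+ + n)))
    ≡⟨ interchange (rising₂ (+ 2) n) (rising₂ (+ 1) n) (+ n) ⟩
  rising₂ (+ 2) n ℤ.* rising₂ (+ 1) n ℤ.* (+ (2 + (n + n)) ℤ.* + (1 + (n + n)))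
    ≡⟨ cong₂ ℤ._*_ (rising₂[2]*rising₂[1]≡[n+n]! n) (sym (ℤ.pos-* (2 + (n + n)) (1 + (n + n)))) ⟩
  + ((n + n) !) ℤ.* + ((2 + (n + n)) * (1 + (n + n)))
    ≡⟨ ℤ.pos-* ((n + n) !) _ ⟨
  + ((n + n) ! * ((2 + (n + n)) * (1 + (n + n))))
    ≡⟨ cong +_ (regroup ((n + n) !) (n + n)) ⟩
  + ((2 + (n + n)) !)
    ≡⟨ cong (λ k → + (suc k !)) (+-suc n n) ⟨
  + ((suc n + suc n) !) ∎
  where
  open ≡-Reasoning
  interchange : ∀ x y n → x ℤ.* (+ 2 ℤ.+ (n ℤ.+ n)) ℤ.* (y ℤ.* (+ 1 ℤ.+ (n ℤ.+ n)))
                          ≡ x ℤ.* y ℤ.* ((+ 2 ℤ.+ (n ℤ.+ n)) ℤ.* (+ 1 ℤ.+ (n ℤ.+ n)))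
  interchange = ℤ-Solver.solve-∀
  regroup : ∀ f k → f * ((2 + k) * (1 + k)) ≡ (2 + k) * ((1 + k) * f)
  regroup = solve-∀

-- Gauss's lemma for 2: modulo 4m + 1 the factors 2m + 2, …, 4m of 2 ⋅ 4 ⋯ 4m = 2^(2m) (2m)!
-- are -(2m - 1), …, -3, -1, which together with 2, 4, …, 2m make up (-1)^m (2m)!.
2^[2m]*[2m]!≡[-1]^m*[2m]! : ∀ m → ∃[ c ] + (2 ^ (m + m) * (m + m) !) ≡ -1ℤ ℤ.^ m ℤ.* + ((m + m) !) ℤ.+ c ℤ.* + (1 + 4 * m)
2^[2m]*[2m]!≡[-1]^m*[2m]! m with rising₂-reflect m (+ 2 ℤ.+ (+ m ℤ.+ + m)) -1ℤ
... | c , eq = rising₂ (+ 2) m ℤ.* c , (begin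
  + (2 ^ (m + m) * (m + m) !)
    ≡⟨ rising₂[2]≡2^n*n! (m + m) ⟨
  rising₂ (+ 2) (m + m)
    ≡⟨ rising₂-+ (+ 2) m m ⟩
  rising₂ (+ 2) m ℤ.* rising₂ (+ 2 ℤ.+ (+ m ℤ.+ + m)) m
    ≡⟨ cong (rising₂ (+ 2) m ℤ.*_) (trans eq (cong (λ r → -1ℤ ℤ.^ m ℤ.* rising₂ (+ 1) m ℤ.+ c ℤ.* + r) (modulus m))) ⟩
  rising₂ (+ 2) m ℤ.* (-1ℤ ℤ.^ m ℤ.* rising₂ (+ 1) m ℤ.+ c ℤ.* + (1 + 4 * m))
    ≡⟨ regroup (rising₂ (+ 2) m) (rising₂ (+ 1) m) (-1ℤ ℤ.^ m) c (+ (1 + 4 * m)) ⟩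
  -1ℤ ℤ.^ m ℤ.* (rising₂ (+ 2) m ℤ.* rising₂ (+ 1) m) ℤ.+ rising₂ (+ 2) m ℤ.* c ℤ.* + (1 + 4 * m)
    ≡⟨ cong (λ x → -1ℤ ℤ.^ m ℤ.* x ℤ.+ rising₂ (+ 2) m ℤ.* c ℤ.* + (1 + 4 * m)) (rising₂[2]*rising₂[1]≡[n+n]! m) ⟩
  -1ℤ ℤ.^ m ℤ.* + ((m + m) !) ℤ.+ rising₂ (+ 2) m ℤ.* c ℤ.* + (1 + 4 * m) ∎)
  where
  open ≡-Reasoning
  modulus : ∀ m → suc (m + m) + (m + m) ≡ 1 + 4 * m
  modulus = solve-∀
  regroup : ∀ x y e c r → x ℤ.* (e ℤ.* y ℤ.+ c ℤ.* r) ≡ e ℤ.* (x ℤ.* y) ℤ.+ x ℤ.* c ℤ.* r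
  regroup = ℤ-Solver.solve-∀

prime⇒∤! : ∀ {p} → Prime p → ∀ n → n < p → p ∤ n !
prime⇒∤! p-prime zero    _   p∣1   = ¬prime[1] (subst Prime (∣1⇒≡1 p∣1) p-prime)
prime⇒∤! p-prime (suc n) n<p p∣n! with euclidsLemma (suc n) (n !) p-prime p∣n!
... | inj₁ p∣1+n = >⇒∤ n<p p∣1+n
... | inj₂ p∣n!  = prime⇒∤! p-prime n (<-trans (n<1+n n) n<p) p∣n!

prime≡1[4]⇒∣2^[2m]-[-1]^m : ∀ m → Prime (1 + 4 * m) → 1 + 4 * m ∣ ℤ.∣ + (2 ^ (m + m)) ℤ.- -1ℤ ℤ.^ m ∣
prime≡1[4]⇒∣2^[2m]-[-1]^m m r-prime with 2^[2m]*[2m]!≡[-1]^m*[2m]! m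
... | c , eq = [ id , (λ r∣[2m]! → contradiction r∣[2m]! (prime⇒∤! r-prime (m + m) 2m<r)) ]′
                 (euclidsLemma ℤ.∣ + (2 ^ (m + m)) ℤ.- ε ∣ ((m + m) !) r-prime (divides ℤ.∣ c ∣ abs-eq))
  where
  ε : ℤ
  ε = -1ℤ ℤ.^ m
  cancel : ∀ x f e c r → x ℤ.* f ≡ e ℤ.* f ℤ.+ c ℤ.* r → (x ℤ.- e) ℤ.* f ≡ c ℤ.* r
  cancel x f e c r xf≡ = begin
    (x ℤ.- e) ℤ.* f               ≡⟨ distrib x f e ⟩
    x ℤ.* f ℤ.- e ℤ.* f           ≡⟨ cong (ℤ._- e ℤ.* f) xf≡ ⟩
    e ℤ.* f ℤ.+ c ℤ.* r ℤ.- e ℤ.* f ≡⟨ simplify (e ℤ.* f) (c ℤ.* r) ⟩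
    c ℤ.* r                       ∎
    where
    open ≡-Reasoning
    distrib : ∀ x f e → (x ℤ.- e) ℤ.* f ≡ x ℤ.* f ℤ.- e ℤ.* f
    distrib = ℤ-Solver.solve-∀
    simplify : ∀ a b → a ℤ.+ b ℤ.- a ≡ b
    simplify = ℤ-Solver.solve-∀
  abs-eq : ℤ.∣ + (2 ^ (m + m)) ℤ.- ε ∣ * (m + m) ! ≡ ℤ.∣ c ∣ * (1 + 4 * m)
  abs-eq = begin
    ℤ.∣ + (2 ^ (m + m)) ℤ.- ε ∣ * (m + m) !
      ≡⟨ ℤ.abs-* (+ (2 ^ (m + m)) ℤ.- ε) (+ ((m + m) !)) ⟨
    ℤ.∣ (+ (2 ^ (m + m)) ℤ.- ε) ℤ.* + ((m + m) !) ∣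
      ≡⟨ cong ℤ.∣_∣ (cancel (+ (2 ^ (m + m))) (+ ((m + m) !)) ε c (+ (1 + 4 * m))
                            (trans (sym (ℤ.pos-* (2 ^ (m + m)) ((m + m) !))) eq)) ⟩
    ℤ.∣ c ℤ.* + (1 + 4 * m) ∣
      ≡⟨ ℤ.abs-* c (+ (1 + 4 * m)) ⟩
    ℤ.∣ c ∣ * (1 + 4 * m) ∎
    where open ≡-Reasoning
  2m<r : m + m < 1 + 4 * m
  2m<r = s≤s (+-monoʳ-≤ m (m≤m+n m _))

[-1]^odd : ∀ t → -1ℤ ℤ.^ suc (2 * t) ≡ -1ℤ
[-1]^odd t = cong (ℤ._*_ -1ℤ) (trans (sym (ℤ.^-*-assoc -1ℤ 2 t)) (ℤ.^-zeroˡ t))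

prime≡5[8]⇒∣1+2^[2+4t] : ∀ t → Prime (8 * t + 5) → 8 * t + 5 ∣ 1 + 2 ^ (2 + 4 * t)
prime≡5[8]⇒∣1+2^[2+4t] t r-prime = subst₂ (λ r n → r ∣ 1 + 2 ^ n) (r≡ t) (2m≡ t) (subst (1 + 4 * m ∣_) (+-comm _ 1) r∣2^[2m]+1)
  where
  m : ℕ
  m = suc (2 * t)
  r≡ : ∀ t → 1 + 4 * suc (2 * t) ≡ 8 * t + 5
  r≡ = solve-∀
  2m≡ : ∀ t → suc (2 * t) + suc (2 * t) ≡ 2 + 4 * t
  2m≡ = solve-∀
  r∣2^[2m]+1 : 1 + 4 * m ∣ 2 ^ (m + m) + 1
  r∣2^[2m]+1 = subst (λ ε → 1 + 4 * m ∣ ℤ.∣ + (2 ^ (m + m)) ℤ.- ε ∣) ([-1]^odd t)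
                     (prime≡1[4]⇒∣2^[2m]-[-1]^m m (subst Prime (sym (r≡ t)) r-prime))

coprime⇒*∣ : ∀ {m n x} → Coprime m n → m ∣ x → n ∣ x → m * n ∣ x
coprime⇒*∣ {m} {n} coprime m∣x (divides q refl) = *-monoˡ-∣ n (coprime-divisor coprime (subst (m ∣_) (*-comm q n) m∣x))

5*[8t+5]∣1+2^[2+4t] : ∀ {t} → 1 ≤ t → Prime (8 * t + 5) → 5 * (8 * t + 5) ∣ 1 + 2 ^ (2 + 4 * t)
5*[8t+5]∣1+2^[2+4t] {t} 1≤t r-prime =
  coprime⇒*∣ (Coprime.sym (prime⇒coprime r-prime (m<n+m 5 (*-monoʳ-< 8 1≤t))))
             (5∣1+2^[2+4u] t) (prime≡5[8]⇒∣1+2^[2+4t] t r-prime)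

FlankedBy14 : ℕ → Set
FlankedBy14 n = (∃[ k ] S k n) × ((k : ℕ) → S k n → ∃[ j ] (k ≡ suc j × S j 14 × S (suc k) 14))

14∈S[k±1] : ∀ k → (∃[ u ] suc k ≡ 2 + 4 * u) → ∃[ j ] (k ≡ suc j × S j 14 × S (suc k) 14)
14∈S[k±1] k (u , 1+k≡) =
  4 * u , suc-injective 1+k≡ ,
  subst (λ j → S j 14) (2*2u≡ u) (14∈S[2v] (2 * u)) ,
  subst (λ j → S j 14) (sym (trans 1+k≡ (2+4u≡ u))) (14∈S[2v] (suc (2 * u)))
  where
  2*2u≡ : ∀ u → 2 * (2 * u) ≡ 4 * u
  2*2u≡ = solve-∀
  2+4u≡ : ∀ u → 2 + 4 * u ≡ 2 * suc (2 * u)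
  2+4u≡ = solve-∀

flankedBy14 : ∀ {s} → Prime (suc (2 * s)) → 5 ∣ s → (∃[ k ] s ∣ 1 + 2 ^ suc k) → FlankedBy14 (2 * suc (2 * s))
flankedBy14 p-prime 5∣s (k , s∣) =
  (k , Equivalence.from (S[2p]⇔ p-prime k) s∣) ,
  λ k 2p∈Sₖ → 14∈S[k±1] k (5∣1+2^n⇒n≡2+4u (suc k) (∣-trans 5∣s (Equivalence.to (S[2p]⇔ p-prime k) 2p∈Sₖ)))

-- At n = 0 and n = 1 the product takes the coprime values 255 = 3 ⋅ 5 ⋅ 17 and 1703 = 13 ⋅ 131.
8n+5,80n+51-admissible : (q : ℕ) → Prime q → ∃[ n ] ¬ ((+ q) ∣ℤ ((+ 8 ℤ.* n ℤ.+ + 5) ℤ.* (+ 80 ℤ.* n ℤ.+ + 51)))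
8n+5,80n+51-admissible q q-prime with q ∣? 255
... | no  q∤255 = + 0 , q∤255
... | yes q∣255 = + 1 , λ q∣1703 → ¬prime[1] (subst Prime (∣1⇒≡1 (gcd-greatest q∣255 q∣1703)) q-prime)

pos-affine-injective : ∀ a b t n → + a ℤ.* + t ℤ.+ + b ≡ + n → a * t + b ≡ n
pos-affine-injective a b t n eq = ℤ.+-injective (trans (cong (ℤ._+ + b) (ℤ.pos-* a t)) eq)

theorem5p1 : HardyLittlewoodPairs →
    (N : ℕ) → ∃[ p ] (N < p × Prime p ×
      (∃[ k ] S k (2 * p)) ×
      ((k : ℕ) → S k (2 * p) → ∃[ j ] (k ≡ suc j × S j 14 × S (suc k) 14)))
theorem5p1 hl N with hl (+ 8) (+ 5) (+ 80) (+ 51) (+<+ (s≤s z≤n)) (+<+ (s≤s z≤n)) refl refl 8n+5,80n+51-admissible (+ N)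
... | + t , +<+ N<t , (r , r≡ , r-prime) , (p , p≡ , p-prime) =
  suc (2 * s) , N<p , p-prime′ ,
  flankedBy14 p-prime′ (m∣m*n (8 * t + 5)) (1 + 4 * t , 5*[8t+5]∣1+2^[2+4t] 1≤t (subst Prime r≡8t+5 r-prime))
  where
  s : ℕ
  s = 5 * (8 * t + 5)
  r≡8t+5 : r ≡ 8 * t + 5
  r≡8t+5 = sym (pos-affine-injective 8 5 t r r≡)
  p≡1+2s : ∀ t → 80 * t + 51 ≡ suc (2 * (5 * (8 * t + 5)))
  p≡1+2s = solve-∀
  p-prime′ : Prime (suc (2 * s))
  p-prime′ = subst Prime (trans (sym (pos-affine-injective 80 51 t p p≡)) (p≡1+2s t)) p-prime
  1≤t : 1 ≤ t
  1≤t = <-≤-trans (s≤s z≤n) N<t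
  N<p : N < suc (2 * s)
  N<p = ≤-trans N<t (≤-trans (subst (t ≤_) (2s≡ t) (m≤m+n t (79 * t + 50))) (n≤1+n (2 * s)))
    where
    2s≡ : ∀ t → t + (79 * t + 50) ≡ 2 * (5 * (8 * t + 5))
    2s≡ = solve-∀
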